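{- Let $M_6$ be the Turing machine with states $A,B,C,D,E,F$ (plus the halting state $H$), symbols $0,1$ ($0$ blank) and transition table $\delta(A,0)=(1,R,B)$, $\delta(A,1)=(0,R,F)$; $\delta(B,0)=(0,L,B)$, $\delta(B,1)=(1,L,C)$; $\delta(C,0)=(1,L,D)$, $\delta(C,1)=(0,R,C)$; $\delta(D,0)=(1,L,E)$, $\delta(D,1)=(1,R,H)$; $\delta(E,0)=(1,L,F)$, $\delta(E,1)=(0,L,D)$; $\delta(F,0)=(1,R,A)$, $\delta(F,1)=(0,L,E)$. For integers $n,p \ge 0$ let $C(n,p) = {}^\omega 0\,(F0)\,(1\,0)^n\,\mathrm{R}(\mathrm{bin}(p))\,0^\omega$ (so that $C(k,4m+1)=C(k+1,m)$). Then (a) ${}^\omega 0(A0)0^\omega \vdash(6)\ C(0,15)$, and, for all integers $k,m\ge 0$: (b) $C(k,4m+3) \vdash(4k+6)\ C(k+2,m)$; (c) $C(2k,4m) \vdash(30k^2+20k+15)\ C(5k+2,2m+1)$; (d) $C(2k+1,4m) \vdash(30k^2+40k+25)\ C(5k+2,32m+20)$; (e) $C(k,8m+2) \vdash(8k+20)\ C(k+3,2m+1)$; (f) $C(2k,16m+6) \vdash(30k^2+40k+23)\ C(5k+2,32m+20)$; (g) $C(2k+1,16m+6) \vdash(30k^2+80k+63)\ C(5k+7,2m+1)$; (h) $C(k,32m+14) \vdash(4k+18)\ C(k+3,2m+1)$; (i) $C(2k,128m+94) \vdash(30k^2+40k+39)\ C(5k+2,256m+84)$; (j) $C(2k+1,128m+94)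 \vdash(30k^2+80k+79)\ C(5k+9,m)$; (k) $C(k,256m+190) \vdash(4k+34)\ C(k+5,m)$; (l) $C(k,512m+30) \vdash(2k+43)\ {}^\omega 0\,(1\,0)^k\,1\,(H0)\,(1\,0)^2\,(0\,1)^2\,\mathrm{R}(\mathrm{bin}(m))\,0^\omega$.
   Context: Turing machines here have one tape, infinite in both directions. $\delta(q,a)=(b,D,q')$ means: in state $q$ reading symbol $a$, the machine writes $b$ on the current cell, moves the head one cell left ($D=L$) or right ($D=R$), and enters state $q'$. When the machine enters the halting state $H$ it stops. A configuration is written ${}^\omega 0\, x\,(S a)\, y\, 0^\omega$, where $x,y$ are finite words: the tape contains the word $xay$ surrounded on both sides by infinitely many $0$'s, the machine is in state $S$, and the head scans the cell containing the displayed symbol $a$. Each digit is one tape symbol; $w^n$ denotes the concatenation of $n$ copies of the word $w$ (parentheses delimit the repeated word), $w^0$ is empty. $\mathrm{bin}(p)$ is the usual binary writing of $p$ (most significant bit first; for $p=0$ one may take it empty, which gives the same configuration since it is followed by $0^\omega$), and $\mathrm{R}(w_1\ldots w_n) = w_n\ldots w_1$ is the reversal of a word. $C_1 \vdash(t)\ C_2$ means that the machine, started in configuration $C_1$, is in configuration $C_2$ after exactly $t$ steps. -}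

module Defs where

open import Data.Nat using (ℕ; zero; suc; _+_; _*_; _/_; _%_)
open import Data.List using (List; []; _∷_; _++_; reverse)
open import Data.Maybe using (Maybe; just; nothing; map)
open import Data.Product using (_×_; _,_)
open import Relation.Binary.PropositionalEquality using (_≡_)

data Sym : Set where
  s0 s1 : Sym

data State : Set where
  A B C D E F H : State

data Dir : Set where
  L R : Dir

-- A configuration  ^ω0 x (S a) y 0^ω  is represented as
--   cfg S (reverse x) a y
-- i.e. the left part is stored nearest-cell-first; both lists are
-- implicitly followed by infinitely many 0's.
record Config : Set where
  constructor cfg
  field
    state : State
    left  : List Sym
    head  : Sym
    right : List Sym

δ : State → Sym → Maybe (Sym × Dir × State)
δ A s0 = just (s1 , R , B)
δ A s1 = just (s0 , R , F)
δ B s0 = just (s0 , L , B)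
δ B s1 = just (s1 , L , C)
δ C s0 = just (s1 , L , D)
δ C s1 = just (s0 , R , C)
δ D s0 = just (s1 , L , E)
δ D s1 = just (s1 , R , H)
δ E s0 = just (s1 , L , F)
δ E s1 = just (s0 , L , D)
δ F s0 = just (s1 , R , A)
δ F s1 = just (s0 , L , E)
δ H _  = nothing

move : Dir → State → Sym → List Sym → List Sym → Config
move L q b []       r = cfg q [] s0 (b ∷ r)
move L q b (x ∷ l)  r = cfg q l x (b ∷ r)
move R q b l []       = cfg q (b ∷ l) s0 []
move R q b l (x ∷ r)  = cfg q (b ∷ l) x r

step : Config → Maybe Config
step (cfg q l a r) with δ q a
... | nothing            = nothing
... | just (b , d , q')  = just (move d q' b l r)

run : ℕ → Config → Maybe Config
run zero    c = just c
run (suc t) c with step c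
... | nothing = nothing
... | just c' = run t c'

stripZ : List Sym → List Sym
stripZ [] = []
stripZ (s0 ∷ xs) with stripZ xs
... | [] = []
... | ys@(_ ∷ _) = s0 ∷ ys
stripZ (s1 ∷ xs) = s1 ∷ stripZ xs

-- Normal form: two representations denote the same configuration iff
-- their normal forms are equal.
norm : Config → Config
norm (cfg q l a r) = cfg q (stripZ l) a (stripZ r)

_⊢⟨_⟩_ : Config → ℕ → Config → Set
c₁ ⊢⟨ t ⟩ c₂ = map norm (run t c₁) ≡ just (norm c₂)

pow : ℕ → List Sym → List Sym
pow zero    w = []
pow (suc n) w = w ++ pow n w

-- R(bin(p)): binary digits of p, least significant first (empty for 0).
-- Computed with fuel; fuel p suffices since p / 2 < p for p > 0.
revBinF : ℕ → ℕ → List Sym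
revBinF zero    p = []
revBinF (suc f) zero = []
revBinF (suc f) p@(suc _) = bit (p % 2) ∷ revBinF f (p / 2)
  where
  bit : ℕ → Sym
  bit zero = s0
  bit (suc _) = s1

revBin : ℕ → List Sym
revBin p = revBinF p p

Cnp : ℕ → ℕ → Config
Cnp n p = cfg F [] s0 (pow n (s1 ∷ s0 ∷ []) ++ revBin p)

start : Config
start = cfg A [] s0 []

haltCfg : ℕ → ℕ → Config
haltCfg k m = cfg H (reverse (pow k (s1 ∷ s0 ∷ []) ++ s1 ∷ [])) s0
                    (pow 2 (s1 ∷ s0 ∷ []) ++ pow 2 (s0 ∷ s1 ∷ []) ++ revBin m)

-- Write C(n, p) as the head in state F left of the block (10)^n, followed by the
-- binary digits of p, least significant first.  One pass of the machine sweeps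
-- right across the block (two steps per 10), reacts to the first few low-order
-- digits of p and, unless it halts, sweeps back to the left end, leaving a
-- configuration of the same shape; such a pass costs time linear in n.  Each of
-- (b), (e), (h), (k), (l) is one or two passes.  In (c), (d), (f), (g), (i), (j)
-- the pass "resets" the block: it becomes (01)^n inside the digit string, and
-- every 0101 of it is then digested by a three-pass cycle which lengthens the
-- block by 5; running k such cycles gives the quadratic step counts.  Tapes are
-- only determined up to trailing blanks, and the machine respects this, so every
-- pass can be computed symbolically on lists.
module Submission where

open import Defs
open import Data.Nat using (ℕ; zero; suc; _+_; _*_; _^_; _/_; _%_; _≤_; z≤n; s≤s)
open import Data.Nat.Properties
  using (≤-trans; ≤-pred; ≤-refl; m≤m*n; +-comm; +-suc; +-identityʳ; *-comm; *-identityˡ)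
open import Data.Nat.DivMod using (m/n<m; m%n<n; [m+kn]%n≡m%n; m*n%n≡0; m*n/n≡m; +-distrib-/-∣ʳ)
open import Data.Nat.Divisibility using (n∣m*n)
open import Data.Nat.Tactic.RingSolver using (solve; solve-∀)
open import Data.List using (List; []; _∷_; _++_; reverse; length)
open import Data.List.Properties using (++-assoc; ++-identityʳ; reverse-++)
open import Data.Maybe using (just; nothing)
open import Data.Maybe.Relation.Binary.Pointwise using (Pointwise; just; nothing)
open import Data.Product using (_×_; _,_; proj₁; proj₂)
open import Relation.Binary.PropositionalEquality

pow-comm : ∀ n (w v : List Sym) → pow n w ++ w ++ v ≡ pow (suc n) w ++ v
pow-comm zero    w v = cong (_++ v) (sym (++-identityʳ w))
pow-comm (suc n) w v = begin
  (w ++ pow n w) ++ w ++ v  ≡⟨ ++-assoc w (pow n w) (w ++ v) ⟩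
  w ++ pow n w ++ w ++ v    ≡⟨ cong (w ++_) (pow-comm n w v) ⟩
  w ++ pow (suc n) w ++ v   ≡⟨ ++-assoc w (pow (suc n) w) v ⟨
  (w ++ pow (suc n) w) ++ v ∎
  where open ≡-Reasoning

pow-rotate : ∀ a b n v → a ∷ pow n (b ∷ a ∷ []) ++ v ≡ pow n (a ∷ b ∷ []) ++ a ∷ v
pow-rotate a b zero    v = refl
pow-rotate a b (suc n) v = cong (λ z → a ∷ b ∷ z) (pow-rotate a b n v)

pow-double : ∀ k (w v : List Sym) → pow (k * 2) w ++ v ≡ pow k (w ++ w) ++ v
pow-double zero    w v = refl
pow-double (suc k) w v = begin
  (w ++ w ++ pow (k * 2) w) ++ v ≡⟨ ++-assoc w (w ++ pow (k * 2) w) v ⟩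
  w ++ (w ++ pow (k * 2) w) ++ v ≡⟨ cong (w ++_) (++-assoc w (pow (k * 2) w) v) ⟩
  w ++ w ++ pow (k * 2) w ++ v   ≡⟨ cong (λ z → w ++ w ++ z) (pow-double k w v) ⟩
  w ++ w ++ pow k (w ++ w) ++ v  ≡⟨ ++-assoc w w _ ⟨
  (w ++ w) ++ pow k (w ++ w) ++ v ≡⟨ ++-assoc (w ++ w) (pow k (w ++ w)) v ⟨
  pow (suc k) (w ++ w) ++ v       ∎
  where open ≡-Reasoning

pow-+1 : ∀ n (w v : List Sym) → pow (n + 1) w ++ v ≡ pow n w ++ w ++ v
pow-+1 n w v = trans (cong (λ m → pow m w ++ v) (+-comm n 1)) (sym (pow-comm n w v))

reverse-pow : ∀ n (w : List Sym) → reverse (pow n w) ≡ pow n (reverse w)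
reverse-pow zero    w = refl
reverse-pow (suc n) w = begin
  reverse (w ++ pow n w)            ≡⟨ reverse-++ w (pow n w) ⟩
  reverse (pow n w) ++ reverse w    ≡⟨ cong (_++ reverse w) (reverse-pow n w) ⟩
  pow n (reverse w) ++ reverse w    ≡⟨ cong (pow n (reverse w) ++_) (++-identityʳ (reverse w)) ⟨
  pow n (reverse w) ++ reverse w ++ [] ≡⟨ pow-comm n (reverse w) [] ⟩
  pow (suc n) (reverse w) ++ []     ≡⟨ ++-identityʳ _ ⟩
  pow (suc n) (reverse w)           ∎
  where open ≡-Reasoning

-- Equality of configurations up to trailing blanks

infix 4 _≋_ _≈_

_≋_ : List Sym → List Sym → Set
xs ≋ ys = stripZ xs ≡ stripZ ys

data _≈_ : Config → Config → Set where
  ≈-cfg : ∀ {q a l l' r r'} → l ≋ l' → r ≋ r' → cfg q l a r ≈ cfg q l' a r'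

prepend0 : List Sym → List Sym
prepend0 []       = []
prepend0 (y ∷ ys) = s0 ∷ y ∷ ys

stripZ-s0∷ : ∀ xs → stripZ (s0 ∷ xs) ≡ prepend0 (stripZ xs)
stripZ-s0∷ xs with stripZ xs
... | []     = refl
... | _ ∷ _  = refl

prepend0-injective : ∀ {u v} → prepend0 u ≡ prepend0 v → u ≡ v
prepend0-injective {[]}    {[]}    _    = refl
prepend0-injective {_ ∷ _} {_ ∷ _} refl = refl

prepend0≡[] : ∀ {v} → prepend0 v ≡ [] → v ≡ []
prepend0≡[] {[]} _ = refl

s1∷≢prepend0 : ∀ {u v} {A : Set} → s1 ∷ u ≡ prepend0 v → A
s1∷≢prepend0 {v = []} ()

head₀ : List Sym → Sym
head₀ []      = s0
head₀ (x ∷ _) = x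

tail₀ : List Sym → List Sym
tail₀ []       = []
tail₀ (_ ∷ xs) = xs

≋-uncons : ∀ l l' → l ≋ l' → head₀ l ≡ head₀ l' × tail₀ l ≋ tail₀ l'
≋-uncons []        []        _  = refl , refl
≋-uncons []        (s0 ∷ ys) eq = refl , sym (prepend0≡[] (trans (sym (stripZ-s0∷ ys)) (sym eq)))
≋-uncons (s0 ∷ xs) []        eq = refl , prepend0≡[] (trans (sym (stripZ-s0∷ xs)) eq)
≋-uncons (s0 ∷ xs) (s0 ∷ ys) eq =
  refl , prepend0-injective (trans (sym (stripZ-s0∷ xs)) (trans eq (stripZ-s0∷ ys)))
≋-uncons (s0 ∷ xs) (s1 ∷ ys) eq = s1∷≢prepend0 (trans (sym eq) (stripZ-s0∷ xs))
≋-uncons (s1 ∷ xs) (s0 ∷ ys) eq = s1∷≢prepend0 (trans eq (stripZ-s0∷ ys))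
≋-uncons (s1 ∷ xs) (s1 ∷ ys) eq = refl , cong tail₀ eq

∷-≋ : ∀ b {l l'} → l ≋ l' → b ∷ l ≋ b ∷ l'
∷-≋ s1 eq = cong (s1 ∷_) eq
∷-≋ s0 {l} {l'} eq = trans (stripZ-s0∷ l) (trans (cong prepend0 eq) (sym (stripZ-s0∷ l')))

++-≋ : ∀ x {y y'} → y ≋ y' → x ++ y ≋ x ++ y'
++-≋ []      eq = eq
++-≋ (b ∷ x) eq = ∷-≋ b (++-≋ x eq)

move-L : ∀ q b l r → move L q b l r ≡ cfg q (tail₀ l) (head₀ l) (b ∷ r)
move-L q b []      r = refl
move-L q b (_ ∷ _) r = refl

move-R : ∀ q b l r → move R q b l r ≡ cfg q (b ∷ l) (head₀ r) (tail₀ r)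
move-R q b l []      = refl
move-R q b l (_ ∷ _) = refl

step-≈ : ∀ {c d} → c ≈ d → Pointwise _≈_ (step c) (step d)
step-≈ (≈-cfg {q} {a} {l} {l'} {r} {r'} l≋l' r≋r') with δ q a
... | nothing = nothing
... | just (b , L , q') rewrite move-L q' b l r | move-L q' b l' r' | proj₁ (≋-uncons l l' l≋l') =
  just (≈-cfg (proj₂ (≋-uncons l l' l≋l')) (∷-≋ b r≋r'))
... | just (b , R , q') rewrite move-R q' b l r | move-R q' b l' r' | proj₁ (≋-uncons r r' r≋r') =
  just (≈-cfg (∷-≋ b l≋l') (proj₂ (≋-uncons r r' r≋r')))

run-≈ : ∀ t {c d} → c ≈ d → Pointwise _≈_ (run t c) (run t d)
run-≈ zero    c≈d = just c≈d
run-≈ (suc t) {c} {d} c≈d with step c | step d | step-≈ c≈d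
... | nothing | nothing | nothing    = nothing
... | just _  | just _  | just c'≈d' = run-≈ t c'≈d'

norm-≈ : ∀ {c d} → c ≈ d → norm c ≡ norm d
norm-≈ (≈-cfg l≋l' r≋r') = cong₂ (λ l r → cfg _ l _ r) l≋l' r≋r'

≈-refl : ∀ {c} → c ≈ c
≈-refl {cfg _ _ _ _} = ≈-cfg refl refl

≡⇒≈ : ∀ {c d} → c ≡ d → c ≈ d
≡⇒≈ refl = ≈-refl

infix 4 _⟶⟨_⟩_
infixr 5 _⨾_

record _⟶⟨_⟩_ (c : Config) (t : ℕ) (c' : Config) : Set where
  constructor runs-to
  field run≡ : run t c ≡ just c'

run-+ : ∀ a {b c₁ c₂ c₃} → run a c₁ ≡ just c₂ → run b c₂ ≡ just c₃ → run (a + b) c₁ ≡ just c₃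
run-+ zero refl q = q
run-+ (suc a) {c₁ = c₁} p q with step c₁
run-+ (suc a) () q | nothing
run-+ (suc a) p q | just _ = run-+ a p q

_⨾_ : ∀ {a b c₁ c₂ c₃} → c₁ ⟶⟨ a ⟩ c₂ → c₂ ⟶⟨ b ⟩ c₃ → c₁ ⟶⟨ a + b ⟩ c₃
_⨾_ {a} (runs-to p) (runs-to q) = runs-to (run-+ a p q)

retime : ∀ {t t' c d} → c ⟶⟨ t ⟩ d → t ≡ t' → c ⟶⟨ t' ⟩ d
retime p refl = p

≡⟶ : ∀ {t c c' d} → c ≡ c' → c' ⟶⟨ t ⟩ d → c ⟶⟨ t ⟩ d
≡⟶ refl p = p

⟶≡ : ∀ {t c d d'} → c ⟶⟨ t ⟩ d → d ≡ d' → c ⟶⟨ t ⟩ d'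
⟶≡ p refl = p

-- The goal d ⊢⟨ t ⟩ e unfolds to an equation about run, so Agda cannot read t off
-- it: uses below fix the step count through the first argument.
⟶⇒⊢ : ∀ {t c c' d e} → c ⟶⟨ t ⟩ c' → c ≈ d → c' ≈ e → d ⊢⟨ t ⟩ e
⟶⇒⊢ {t} {d = d} (runs-to run≡) c≈d c'≈e
  with run t d | subst (λ x → Pointwise _≈_ x (run t d)) run≡ (run-≈ t c≈d)
... | just _ | just c'≈d' = cong just (trans (sym (norm-≈ c'≈d')) (norm-≈ c'≈e))

sweep-right : ∀ {q a t} (u v : List Sym) → (∀ l r → cfg q l a (u ++ r) ⟶⟨ t ⟩ cfg q (v ++ l) a r)
            → ∀ n l r → cfg q l a (pow n u ++ r) ⟶⟨ n * t ⟩ cfg q (pow n v ++ l) a r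
sweep-right u v one zero    l r = runs-to refl
sweep-right {q} {a} u v one (suc n) l r =
  ≡⟶ (cong (cfg q l a) (++-assoc u (pow n u) r))
     (one l (pow n u ++ r) ⨾ ⟶≡ (sweep-right u v one n (v ++ l) r) (cong (λ l' → cfg q l' a r) (pow-comm n v l)))

sweep-left : ∀ {q a t} (u v : List Sym) → (∀ l r → cfg q (u ++ l) a r ⟶⟨ t ⟩ cfg q l a (v ++ r))
           → ∀ n l r → cfg q (pow n u ++ l) a r ⟶⟨ n * t ⟩ cfg q l a (pow n v ++ r)
sweep-left u v one zero    l r = runs-to refl
sweep-left {q} {a} u v one (suc n) l r =
  ≡⟶ (cong (λ l' → cfg q l' a r) (++-assoc u (pow n u) l))
     (one (pow n u ++ l) r ⨾ ⟶≡ (sweep-left u v one n l (v ++ r)) (cong (cfg q l a) (pow-comm n v r)))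

w10 w01 w0101 : List Sym
w10   = s1 ∷ s0 ∷ []
w01   = s0 ∷ s1 ∷ []
w0101 = s0 ∷ s1 ∷ s0 ∷ s1 ∷ []

sweep-F : ∀ n l r → cfg F l s0 (pow n w10 ++ r) ⟶⟨ n * 2 ⟩ cfg F (pow n w01 ++ l) s0 r
sweep-F = sweep-right w10 w01 (λ _ _ → runs-to refl)

sweep-E₀ : ∀ n l r → cfg E (pow n w10 ++ l) s0 r ⟶⟨ n * 2 ⟩ cfg E l s0 (pow n w01 ++ r)
sweep-E₀ = sweep-left w10 w01 (λ _ _ → runs-to refl)

sweep-E₁ : ∀ n l r → cfg E (pow n w01 ++ l) s1 r ⟶⟨ n * 2 ⟩ cfg E l s1 (pow n w10 ++ r)
sweep-E₁ = sweep-left w01 w10 (λ _ _ → runs-to refl)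

-- Passes over configurations C(n, ·) with an explicit digit string

Cn : ℕ → List Sym → Config
Cn n Y = cfg F [] s0 (pow n w10 ++ Y)

Cn-shift : ∀ j n Y → Cn n (pow j w10 ++ Y) ≡ Cn (j + n) Y
Cn-shift zero    n Y = refl
Cn-shift (suc j) n Y = begin
  Cn n (s1 ∷ s0 ∷ pow j w10 ++ Y) ≡⟨ cong (cfg F [] s0) (pow-comm n w10 (pow j w10 ++ Y)) ⟩
  Cn (suc n) (pow j w10 ++ Y)     ≡⟨ Cn-shift j (suc n) Y ⟩
  Cn (j + suc n) Y                ≡⟨ cong (λ m → Cn m Y) (+-suc j n) ⟩
  Cn (suc j + n) Y                ∎
  where open ≡-Reasoning

Cn-count : ∀ n n' Y → n ≡ n' → Cn n Y ≡ Cn n' Y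
Cn-count n n' Y refl = refl

return-sweep : ∀ n r → cfg E (s1 ∷ pow n w01 ++ []) s0 r ⟶⟨ n * 2 + 3 ⟩ Cn (suc n) (s1 ∷ r)
return-sweep n r =
  ≡⟶ (cong (λ l → cfg E l s0 r) (pow-rotate s1 s0 n []))
     (⟶≡ (sweep-E₀ n (s1 ∷ []) r ⨾ turn) (cong (λ z → Cn 1 z) (pow-rotate s1 s0 n r)))
  where
  turn : cfg E (s1 ∷ []) s0 (pow n w01 ++ r) ⟶⟨ 3 ⟩ Cn 1 (s1 ∷ pow n w01 ++ r)
  turn = runs-to refl

Creset : ℕ → List Sym → Config
Creset n W = Cn 0 (s1 ∷ s1 ∷ pow n w01 ++ s0 ∷ s0 ∷ s1 ∷ s0 ∷ s1 ∷ W)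

return-reset : ∀ n W → cfg E (pow n w01 ++ []) s1 (s0 ∷ s1 ∷ s0 ∷ s1 ∷ W) ⟶⟨ n * 2 + 3 ⟩ Creset n W
return-reset n W = ⟶≡ (sweep-E₁ n [] _ ⨾ turn) (cong (λ z → Cn 0 (s1 ∷ s1 ∷ z)) (pow-rotate s0 s1 n _))
  where
  turn : cfg E [] s1 (pow n w10 ++ s0 ∷ s1 ∷ s0 ∷ s1 ∷ W)
         ⟶⟨ 3 ⟩ Cn 0 (s1 ∷ s1 ∷ s0 ∷ pow n w10 ++ s0 ∷ s1 ∷ s0 ∷ s1 ∷ W)
  turn = runs-to refl

pass-11 : ∀ n X → Cn n (s1 ∷ s1 ∷ X) ⟶⟨ 4 * n + 6 ⟩ Cn (2 + n) X
pass-11 n X =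
  retime (sweep-F n [] _ ⨾ turn ⨾ ⟶≡ (return-sweep n (s0 ∷ X)) (Cn-shift 1 (suc n) X)) (solve (n ∷ []))
  where
  turn : cfg F (pow n w01 ++ []) s0 (s1 ∷ s1 ∷ X) ⟶⟨ 3 ⟩ cfg E (s1 ∷ pow n w01 ++ []) s0 (s0 ∷ X)
  turn = runs-to refl

pass-010 : ∀ n X → Cn n (s0 ∷ s1 ∷ s0 ∷ X) ⟶⟨ 4 * n + 10 ⟩ Cn (suc n) (s1 ∷ s1 ∷ s1 ∷ X)
pass-010 n X = retime (sweep-F n [] _ ⨾ turn ⨾ return-sweep n (s1 ∷ s1 ∷ X)) (solve (n ∷ []))
  where
  turn : cfg F (pow n w01 ++ []) s0 (s0 ∷ s1 ∷ s0 ∷ X) ⟶⟨ 7 ⟩ cfg E (s1 ∷ pow n w01 ++ []) s0 (s1 ∷ s1 ∷ X)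
  turn = runs-to refl

pass-01110 : ∀ n X → Cn n (s0 ∷ s1 ∷ s1 ∷ s1 ∷ s0 ∷ X) ⟶⟨ 4 * n + 18 ⟩ Cn (3 + n) (s1 ∷ X)
pass-01110 n X =
  retime (sweep-F n [] _ ⨾ turn ⨾ ⟶≡ (return-sweep (suc n) (s0 ∷ s1 ∷ X)) (Cn-shift 1 (2 + n) (s1 ∷ X)))
         (solve (n ∷ []))
  where
  turn : cfg F (pow n w01 ++ []) s0 (s0 ∷ s1 ∷ s1 ∷ s1 ∷ s0 ∷ X)
         ⟶⟨ 13 ⟩ cfg E (s1 ∷ pow (suc n) w01 ++ []) s0 (s0 ∷ s1 ∷ X)
  turn = runs-to refl

pass-01111101 : ∀ n X → Cn n (s0 ∷ s1 ∷ s1 ∷ s1 ∷ s1 ∷ s1 ∷ s0 ∷ s1 ∷ X) ⟶⟨ 4 * n + 34 ⟩ Cn (5 + n) X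
pass-01111101 n X =
  retime (sweep-F n [] _ ⨾ turn ⨾ ⟶≡ (return-sweep n _) (Cn-shift 4 (suc n) X))
         (solve (n ∷ []))
  where
  turn : cfg F (pow n w01 ++ []) s0 (s0 ∷ s1 ∷ s1 ∷ s1 ∷ s1 ∷ s1 ∷ s0 ∷ s1 ∷ X)
         ⟶⟨ 31 ⟩ cfg E (s1 ∷ pow n w01 ++ []) s0 (s0 ∷ s1 ∷ s0 ∷ s1 ∷ s0 ∷ s1 ∷ s0 ∷ X)
  turn = runs-to refl

halt-011110000 : ∀ n X → Cn n (s0 ∷ s1 ∷ s1 ∷ s1 ∷ s1 ∷ s0 ∷ s0 ∷ s0 ∷ s0 ∷ X)
                 ⟶⟨ 2 * n + 43 ⟩ cfg H (s1 ∷ pow n w01 ++ []) s0 (pow 2 w10 ++ pow 2 w01 ++ X)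
halt-011110000 n X = retime (sweep-F n [] _ ⨾ turn) (solve (n ∷ []))
  where
  turn : cfg F (pow n w01 ++ []) s0 (s0 ∷ s1 ∷ s1 ∷ s1 ∷ s1 ∷ s0 ∷ s0 ∷ s0 ∷ s0 ∷ X)
         ⟶⟨ 43 ⟩ cfg H (s1 ∷ pow n w01 ++ []) s0 (pow 2 w10 ++ pow 2 w01 ++ X)
  turn = runs-to refl

reset-00 : ∀ n X → Cn (n + 1) (s0 ∷ s0 ∷ X) ⟶⟨ 4 * n + 19 ⟩ Creset n X
reset-00 n X =
  ≡⟶ (Cn-count (n + 1) (suc n) _ (+-comm n 1))
     (retime (sweep-F (suc n) [] _ ⨾ turn ⨾ return-reset n X) (solve (n ∷ [])))
  where
  turn : cfg F (pow (suc n) w01 ++ []) s0 (s0 ∷ s0 ∷ X)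
         ⟶⟨ 14 ⟩ cfg E (pow n w01 ++ []) s1 (s0 ∷ s1 ∷ s0 ∷ s1 ∷ X)
  turn = runs-to refl

reset-0110 : ∀ n X → Cn n (s0 ∷ s1 ∷ s1 ∷ s0 ∷ X) ⟶⟨ 4 * n + 17 ⟩ Creset n X
reset-0110 n X = retime (sweep-F n [] _ ⨾ turn ⨾ return-reset n X) (solve (n ∷ []))
  where
  turn : cfg F (pow n w01 ++ []) s0 (s0 ∷ s1 ∷ s1 ∷ s0 ∷ X)
         ⟶⟨ 14 ⟩ cfg E (pow n w01 ++ []) s1 (s0 ∷ s1 ∷ s0 ∷ s1 ∷ X)
  turn = runs-to refl

reset-0111101 : ∀ n X → Cn n (s0 ∷ s1 ∷ s1 ∷ s1 ∷ s1 ∷ s0 ∷ s1 ∷ X)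
                ⟶⟨ 4 * n + 33 ⟩ Creset n (s0 ∷ s1 ∷ s0 ∷ X)
reset-0111101 n X = retime (sweep-F n [] _ ⨾ turn ⨾ return-reset n (s0 ∷ s1 ∷ s0 ∷ X)) (solve (n ∷ []))
  where
  turn : cfg F (pow n w01 ++ []) s0 (s0 ∷ s1 ∷ s1 ∷ s1 ∷ s1 ∷ s0 ∷ s1 ∷ X)
         ⟶⟨ 30 ⟩ cfg E (pow n w01 ++ []) s1 (s0 ∷ s1 ∷ s0 ∷ s1 ∷ s0 ∷ s1 ∷ s0 ∷ X)
  turn = runs-to refl

pass-00-empty : ∀ X → Cn 0 (s0 ∷ s0 ∷ X) ⟶⟨ 15 ⟩ Cn 2 (s1 ∷ X)
pass-00-empty X = runs-to refl

cycle-0101 : ∀ n Y → Cn n (s0 ∷ s1 ∷ s0 ∷ s1 ∷ Y) ⟶⟨ 12 * n + 38 ⟩ Cn (5 + n) Y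
cycle-0101 n Y =
  retime (pass-010 n (s1 ∷ Y) ⨾ pass-11 (suc n) (s1 ∷ s1 ∷ Y) ⨾ pass-11 (3 + n) Y) (solve (n ∷ []))

cycles-0101 : ∀ j n Y → Cn n (pow j w0101 ++ Y) ⟶⟨ 12 * n * j + 30 * j * j + 8 * j ⟩ Cn (5 * j + n) Y
cycles-0101 zero    n Y = retime (runs-to refl) (solve (n ∷ []))
cycles-0101 (suc j) n Y =
  retime (cycle-0101 n _ ⨾
          ⟶≡ (cycles-0101 j (5 + n) Y) (Cn-count (5 * j + (5 + n)) (5 * suc j + n) Y (solve (j ∷ n ∷ []))))
         (solve (j ∷ n ∷ []))

from-reset-even : ∀ k V → Cn 0 (s1 ∷ s1 ∷ pow (2 * k) w01 ++ V)
                          ⟶⟨ 30 * k * k + 32 * k + 6 ⟩ Cn (5 * k + 2) V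
from-reset-even k V =
  retime (pass-11 0 _ ⨾ ≡⟶ (cong (Cn 2) (trans (cong (λ n → pow n w01 ++ V) (*-comm 2 k)) (pow-double k w01 V)))
                            (cycles-0101 k 2 V))
         (solve (k ∷ []))

-- An odd block leaves a last 01 in front of the tail 00101, which two passes absorb.
from-reset-odd : ∀ k W → Creset (2 * k + 1) W ⟶⟨ 30 * k * k + 72 * k + 42 ⟩ Cn (5 * k + 7) (s1 ∷ W)
from-reset-odd k W =
  ≡⟶ (cong (λ z → Cn 0 (s1 ∷ s1 ∷ z)) (pow-+1 (2 * k) w01 _))
     (retime (from-reset-even k _ ⨾ pass-010 (5 * k + 2) _ ⨾
              ⟶≡ (pass-11 (suc (5 * k + 2)) (pow 2 w10 ++ s1 ∷ W))
                  (trans (Cn-shift 2 (2 + suc (5 * k + 2)) (s1 ∷ W))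
                         (Cn-count (2 + (2 + suc (5 * k + 2))) (5 * k + 7) _ (solve (k ∷ [])))))
             (solve (k ∷ [])))

-- Binary digits

suc-/2≤ : ∀ p → suc p / 2 ≤ p
suc-/2≤ p = ≤-pred (m/n<m (suc p) 2 (s≤s (s≤s z≤n)))

revBinF-fuel : ∀ f g p → p ≤ f → p ≤ g → revBinF f p ≡ revBinF g p
revBinF-fuel zero    zero    zero _ _ = refl
revBinF-fuel zero    (suc g) zero _ _ = refl
revBinF-fuel (suc f) zero    zero _ _ = refl
revBinF-fuel (suc f) (suc g) zero _ _ = refl
revBinF-fuel (suc f) (suc g) (suc p) (s≤s p≤f) (s≤s p≤g)
  with suc p % 2 | m%n<n (suc p) 2
     | revBinF-fuel f g (suc p / 2) (≤-trans (suc-/2≤ p) p≤f) (≤-trans (suc-/2≤ p) p≤g)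
... | 0           | _            | ih = cong (s0 ∷_) ih
... | 1           | _            | ih = cong (s1 ∷_) ih
... | suc (suc _) | s≤s (s≤s ()) | _

[1+m*2]%2≡1 : ∀ m → suc (m * 2) % 2 ≡ 1
[1+m*2]%2≡1 m = [m+kn]%n≡m%n 1 m 2

[1+m*2]/2≡m : ∀ m → suc (m * 2) / 2 ≡ m
[1+m*2]/2≡m m = trans (+-distrib-/-∣ʳ 1 {d = 2} (n∣m*n m)) (m*n/n≡m m 2)

[2+m*2]%2≡0 : ∀ m → suc (suc (m * 2)) % 2 ≡ 0
[2+m*2]%2≡0 m = m*n%n≡0 (suc m) 2

[2+m*2]/2≡1+m : ∀ m → suc (suc (m * 2)) / 2 ≡ suc m
[2+m*2]/2≡1+m m = m*n/n≡m (suc m) 2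

revBin-odd : ∀ m → revBin (1 + m * 2) ≡ s1 ∷ revBin m
revBin-odd m rewrite [1+m*2]%2≡1 m | [1+m*2]/2≡m m =
  cong (s1 ∷_) (revBinF-fuel (m * 2) m m (m≤m*n m 2) ≤-refl)

revBin-even : ∀ m → revBin (m * 2) ≋ s0 ∷ revBin m
revBin-even zero    = refl
revBin-even (suc m) rewrite [2+m*2]%2≡0 m | [2+m*2]/2≡1+m m =
  cong (λ z → stripZ (s0 ∷ z)) (revBinF-fuel (suc (m * 2)) (suc m) (suc m) (s≤s (m≤m*n m 2)) ≤-refl)

lowBits : List Sym → ℕ
lowBits []        = 0
lowBits (s0 ∷ bs) = lowBits bs * 2
lowBits (s1 ∷ bs) = 1 + lowBits bs * 2

revBin-lowBits : ∀ bs m → revBin (2 ^ length bs * m + lowBits bs) ≋ bs ++ revBin m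
revBin-lowBits []        m = cong (λ p → stripZ (revBin p)) (trans (+-identityʳ (1 * m)) (*-identityˡ m))
revBin-lowBits (s0 ∷ bs) m = begin
  stripZ (revBin (2 * x * m + c * 2))  ≡⟨ cong (λ p → stripZ (revBin p)) (double x m c) ⟩
  stripZ (revBin ((x * m + c) * 2))    ≡⟨ revBin-even (x * m + c) ⟩
  stripZ (s0 ∷ revBin (x * m + c))
    ≡⟨ ∷-≋ s0 {revBin (x * m + c)} {bs ++ revBin m} (revBin-lowBits bs m) ⟩
  stripZ (s0 ∷ bs ++ revBin m)         ∎
  where
  open ≡-Reasoning
  x = 2 ^ length bs
  c = lowBits bs
  double : ∀ x m c → 2 * x * m + c * 2 ≡ (x * m + c) * 2
  double = solve-∀
revBin-lowBits (s1 ∷ bs) m = begin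
  stripZ (revBin (2 * x * m + (1 + c * 2)))  ≡⟨ cong (λ p → stripZ (revBin p)) (double+1 x m c) ⟩
  stripZ (revBin (1 + (x * m + c) * 2))      ≡⟨ cong stripZ (revBin-odd (x * m + c)) ⟩
  stripZ (s1 ∷ revBin (x * m + c))
    ≡⟨ ∷-≋ s1 {revBin (x * m + c)} {bs ++ revBin m} (revBin-lowBits bs m) ⟩
  stripZ (s1 ∷ bs ++ revBin m)               ∎
  where
  open ≡-Reasoning
  x = 2 ^ length bs
  c = lowBits bs
  double+1 : ∀ x m c → 2 * x * m + (1 + c * 2) ≡ 1 + (x * m + c) * 2
  double+1 = solve-∀

Cn≈Cnp : ∀ n bs m {p} → 2 ^ length bs * m + lowBits bs ≡ p → Cn n (bs ++ revBin m) ≈ Cnp n p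
Cn≈Cnp n bs m refl = ≈-cfg refl (++-≋ (pow n w10) (sym (revBin-lowBits bs m)))

start⊢ : start ⊢⟨ 6 ⟩ Cnp 0 15
start⊢ = refl

C[k,4m+3] : ∀ k m → Cnp k (4 * m + 3) ⊢⟨ 4 * k + 6 ⟩ Cnp (k + 2) m
C[k,4m+3] k m =
  ⟶⇒⊢ (⟶≡ (pass-11 k (revBin m)) (Cn-count (2 + k) (k + 2) _ (+-comm 2 k)))
      (Cn≈Cnp k (s1 ∷ s1 ∷ []) m refl) ≈-refl

C[2k,4m] : ∀ k m → Cnp (2 * k) (4 * m) ⊢⟨ 30 * k * k + 20 * k + 15 ⟩ Cnp (5 * k + 2) (2 * m + 1)
C[2k,4m] zero m =
  ⟶⇒⊢ (pass-00-empty (revBin m))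
      (Cn≈Cnp 0 (s0 ∷ s0 ∷ []) m (+-identityʳ (4 * m))) (Cn≈Cnp 2 (s1 ∷ []) m refl)
C[2k,4m] (suc k) m =
  ⟶⇒⊢ (≡⟶ (Cn-count (2 * suc k) (2 * k + 1 + 1) _ (solve (k ∷ [])))
          (retime {t' = 30 * suc k * suc k + 20 * suc k + 15}
                  (reset-00 (2 * k + 1) (revBin m) ⨾
                   ⟶≡ (from-reset-odd k (revBin m)) (Cn-count (5 * k + 7) (5 * suc k + 2) _ (solve (k ∷ []))))
                  (solve (k ∷ []))))
      (Cn≈Cnp (2 * suc k) (s0 ∷ s0 ∷ []) m (+-identityʳ (4 * m)))
      (Cn≈Cnp (5 * suc k + 2) (s1 ∷ []) m refl)

C[2k+1,4m] : ∀ k m → Cnp (2 * k + 1) (4 * m) ⊢⟨ 30 * k * k + 40 * k + 25 ⟩ Cnp (5 * k + 2) (32 * m + 20)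
C[2k+1,4m] k m =
  ⟶⇒⊢ (retime {t' = 30 * k * k + 40 * k + 25}
              (reset-00 (2 * k) (revBin m) ⨾ from-reset-even k _) (solve (k ∷ [])))
      (Cn≈Cnp (2 * k + 1) (s0 ∷ s0 ∷ []) m (+-identityʳ (4 * m)))
      (Cn≈Cnp (5 * k + 2) (s0 ∷ s0 ∷ s1 ∷ s0 ∷ s1 ∷ []) m refl)

C[k,8m+2] : ∀ k m → Cnp k (8 * m + 2) ⊢⟨ 8 * k + 20 ⟩ Cnp (k + 3) (2 * m + 1)
C[k,8m+2] k m =
  ⟶⇒⊢ (retime {t' = 8 * k + 20}
              (pass-010 k (revBin m) ⨾ ⟶≡ (pass-11 (suc k) _) (Cn-count (3 + k) (k + 3) _ (+-comm 3 k)))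
              (solve (k ∷ [])))
      (Cn≈Cnp k (s0 ∷ s1 ∷ s0 ∷ []) m refl) (Cn≈Cnp (k + 3) (s1 ∷ []) m refl)

C[2k,16m+6] : ∀ k m → Cnp (2 * k) (16 * m + 6) ⊢⟨ 30 * k * k + 40 * k + 23 ⟩ Cnp (5 * k + 2) (32 * m + 20)
C[2k,16m+6] k m =
  ⟶⇒⊢ (retime {t' = 30 * k * k + 40 * k + 23}
              (reset-0110 (2 * k) (revBin m) ⨾ from-reset-even k _) (solve (k ∷ [])))
      (Cn≈Cnp (2 * k) (s0 ∷ s1 ∷ s1 ∷ s0 ∷ []) m refl)
      (Cn≈Cnp (5 * k + 2) (s0 ∷ s0 ∷ s1 ∷ s0 ∷ s1 ∷ []) m refl)

C[2k+1,16m+6] : ∀ k m → Cnp (2 * k + 1) (16 * m + 6) ⊢⟨ 30 * k * k + 80 * k + 63 ⟩ Cnp (5 * k + 7) (2 * m + 1)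
C[2k+1,16m+6] k m =
  ⟶⇒⊢ (retime {t' = 30 * k * k + 80 * k + 63}
              (reset-0110 (2 * k + 1) (revBin m) ⨾ from-reset-odd k (revBin m)) (solve (k ∷ [])))
      (Cn≈Cnp (2 * k + 1) (s0 ∷ s1 ∷ s1 ∷ s0 ∷ []) m refl) (Cn≈Cnp (5 * k + 7) (s1 ∷ []) m refl)

C[k,32m+14] : ∀ k m → Cnp k (32 * m + 14) ⊢⟨ 4 * k + 18 ⟩ Cnp (k + 3) (2 * m + 1)
C[k,32m+14] k m =
  ⟶⇒⊢ (⟶≡ (pass-01110 k (revBin m)) (Cn-count (3 + k) (k + 3) _ (+-comm 3 k)))
      (Cn≈Cnp k (s0 ∷ s1 ∷ s1 ∷ s1 ∷ s0 ∷ []) m refl) (Cn≈Cnp (k + 3) (s1 ∷ []) m refl)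

C[2k,128m+94] : ∀ k m → Cnp (2 * k) (128 * m + 94) ⊢⟨ 30 * k * k + 40 * k + 39 ⟩ Cnp (5 * k + 2) (256 * m + 84)
C[2k,128m+94] k m =
  ⟶⇒⊢ (retime {t' = 30 * k * k + 40 * k + 39}
              (reset-0111101 (2 * k) (revBin m) ⨾ from-reset-even k _) (solve (k ∷ [])))
      (Cn≈Cnp (2 * k) (s0 ∷ s1 ∷ s1 ∷ s1 ∷ s1 ∷ s0 ∷ s1 ∷ []) m refl)
      (Cn≈Cnp (5 * k + 2) (s0 ∷ s0 ∷ s1 ∷ s0 ∷ s1 ∷ s0 ∷ s1 ∷ s0 ∷ []) m refl)

C[2k+1,128m+94] : ∀ k m → Cnp (2 * k + 1) (128 * m + 94) ⊢⟨ 30 * k * k + 80 * k + 79 ⟩ Cnp (5 * k + 9) m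
C[2k+1,128m+94] k m =
  ⟶⇒⊢ (retime {t' = 30 * k * k + 80 * k + 79}
              (reset-0111101 (2 * k + 1) (revBin m) ⨾
               ⟶≡ (from-reset-odd k _)
                   (trans (Cn-shift 2 (5 * k + 7) (revBin m))
                          (Cn-count (2 + (5 * k + 7)) (5 * k + 9) _ (solve (k ∷ [])))))
              (solve (k ∷ [])))
      (Cn≈Cnp (2 * k + 1) (s0 ∷ s1 ∷ s1 ∷ s1 ∷ s1 ∷ s0 ∷ s1 ∷ []) m refl) ≈-refl

C[k,256m+190] : ∀ k m → Cnp k (256 * m + 190) ⊢⟨ 4 * k + 34 ⟩ Cnp (k + 5) m
C[k,256m+190] k m =
  ⟶⇒⊢ (⟶≡ (pass-01111101 k (revBin m)) (Cn-count (5 + k) (k + 5) _ (+-comm 5 k)))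
      (Cn≈Cnp k (s0 ∷ s1 ∷ s1 ∷ s1 ∷ s1 ∷ s1 ∷ s0 ∷ s1 ∷ []) m refl) ≈-refl

C[k,512m+30] : ∀ k m → Cnp k (512 * m + 30) ⊢⟨ 2 * k + 43 ⟩ haltCfg k m
C[k,512m+30] k m =
  ⟶⇒⊢ (halt-011110000 k (revBin m))
      (Cn≈Cnp k (s0 ∷ s1 ∷ s1 ∷ s1 ∷ s1 ∷ s0 ∷ s0 ∷ s0 ∷ s0 ∷ []) m refl)
      (≡⇒≈ (cong (λ l → cfg H l s0 (pow 2 w10 ++ pow 2 w01 ++ revBin m)) left-tape))
  where
  left-tape : s1 ∷ pow k w01 ++ [] ≡ reverse (pow k w10 ++ s1 ∷ [])
  left-tape = sym (begin
    reverse (pow k w10 ++ s1 ∷ [])  ≡⟨ reverse-++ (pow k w10) (s1 ∷ []) ⟩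
    s1 ∷ reverse (pow k w10)        ≡⟨ cong (s1 ∷_) (reverse-pow k w10) ⟩
    s1 ∷ pow k w01                  ≡⟨ cong (s1 ∷_) (++-identityʳ (pow k w01)) ⟨
    s1 ∷ pow k w01 ++ []            ∎)
    where open ≡-Reasoning

theorem8p1 :
    (start ⊢⟨ 6 ⟩ Cnp 0 15)
    × (∀ k m → Cnp k (4 * m + 3) ⊢⟨ 4 * k + 6 ⟩ Cnp (k + 2) m)
    × (∀ k m → Cnp (2 * k) (4 * m) ⊢⟨ 30 * k * k + 20 * k + 15 ⟩ Cnp (5 * k + 2) (2 * m + 1))
    × (∀ k m → Cnp (2 * k + 1) (4 * m) ⊢⟨ 30 * k * k + 40 * k + 25 ⟩ Cnp (5 * k + 2) (32 * m + 20))
    × (∀ k m → Cnp k (8 * m + 2) ⊢⟨ 8 * k + 20 ⟩ Cnp (k + 3) (2 * m + 1))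
    × (∀ k m → Cnp (2 * k) (16 * m + 6) ⊢⟨ 30 * k * k + 40 * k + 23 ⟩ Cnp (5 * k + 2) (32 * m + 20))
    × (∀ k m → Cnp (2 * k + 1) (16 * m + 6) ⊢⟨ 30 * k * k + 80 * k + 63 ⟩ Cnp (5 * k + 7) (2 * m + 1))
    × (∀ k m → Cnp k (32 * m + 14) ⊢⟨ 4 * k + 18 ⟩ Cnp (k + 3) (2 * m + 1))
    × (∀ k m → Cnp (2 * k) (128 * m + 94) ⊢⟨ 30 * k * k + 40 * k + 39 ⟩ Cnp (5 * k + 2) (256 * m + 84))
    × (∀ k m → Cnp (2 * k + 1) (128 * m + 94) ⊢⟨ 30 * k * k + 80 * k + 79 ⟩ Cnp (5 * k + 9) m)
    × (∀ k m → Cnp k (256 * m + 190) ⊢⟨ 4 * k + 34 ⟩ Cnp (k + 5) m)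
    × (∀ k m → Cnp k (512 * m + 30) ⊢⟨ 2 * k + 43 ⟩ haltCfg k m)
theorem8p1 =
  start⊢ , C[k,4m+3] , C[2k,4m] , C[2k+1,4m] , C[k,8m+2] , C[2k,16m+6] , C[2k+1,16m+6] ,
  C[k,32m+14] , C[2k,128m+94] , C[2k+1,128m+94] , C[k,256m+190] , C[k,512m+30]
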